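{- Let $q$ be a prime power, $d \geq 1$, $k \geq 1$, $r \in \mathbb{F}_q \setminus \{0\}$, and let $\emptyset \neq A \subset \{(i,j) : 1 \leq i < j \leq k+1\}$. Let $E \subset \mathbb{F}_q^d$ with $|E| \geq 2k q^{d/2}$ if $d$ is even, or $|E| \geq 2k q^{(d+1)/2}$ if $d$ is odd. Then there exist $(x_1,\dots,x_{k+1}), (y_1,\dots,y_{k+1}) \in E^{k+1}$ such that $\|y_i - y_j\|^2 = r\|x_i - x_j\|^2$ for all $(i,j) \in A$, and $x_i \neq x_j$, $y_i \neq y_j$ for all $1 \leq i < j \leq k+1$.
   Context: $\mathbb{F}_q$ is the finite field with $q$ elements. For $x=(x_1,\dots,x_d) \in \mathbb{F}_q^d$, $\|x\|^2 := x_1^2 + \cdots + x_d^2$. -}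

module Defs where

open import Data.Nat as ℕ using (ℕ; suc; _^_; _≥_)
open import Data.Nat.Primality using (Prime)
open import Data.Fin using (Fin)
open import Data.Vec using (Vec; []; _∷_; zipWith)
open import Data.Product using (Σ; ∃; ∃-syntax; _×_)
open import Relation.Binary.PropositionalEquality using (_≡_)
open import Relation.Nullary using (¬_)
import Algebra.Structures as S

IsPrimePower : ℕ → Set
IsPrimePower q = ∃[ p ] ∃[ n ] (Prime p × n ≥ 1 × q ≡ p ^ n)

-- A field structure on the q-element set Fin q (every finite field with
-- q elements is isomorphic to one of these), with propositional equality.
record FiniteField (q : ℕ) : Set where
  infixl 7 _*_
  infixl 6 _+_
  field
    _+_ _*_ : Fin q → Fin q → Fin q
    -_      : Fin q → Fin q
    0# 1#   : Fin q
    isCommutativeRing : S.IsCommutativeRing _≡_ _+_ _*_ -_ 0# 1#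
    0≢1     : ¬ (0# ≡ 1#)
    inverse : ∀ x → ¬ (x ≡ 0#) → Σ (Fin q) (λ y → x * y ≡ 1#)

  Point : ℕ → Set
  Point d = Vec (Fin q) d

  _-ᵥ_ : ∀ {d} → Point d → Point d → Point d
  x -ᵥ y = zipWith (λ a b → a + (- b)) x y

  ‖_‖² : ∀ {d} → Point d → Fin q
  ‖ [] ‖²     = 0#
  ‖ a ∷ x ‖² = a * a + ‖ x ‖²

{-# OPTIONS --safe #-}

-- Write r = α² + β²; every element of a finite field is a sum of two squares, since
-- otherwise the 2(q − 1) values a² and r − b² (a, b ≠ 0) would avoid 0 and r while
-- taking each value at most twice, contradicting pigeonhole. Multiplying consecutive
-- pairs of coordinates by α + βi is a linear map T with ‖T v‖² = r ‖v‖²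
-- (Brahmagupta–Fibonacci). Colour (x, y) ∈ E² by y − T x, so that y − y′ = T (x − x′)
-- within a colour class. There are q^(2⌈d/2⌉) colours and more than k times as many
-- pairs, so some class holds k + 1 distinct pairs; their x's are distinct because the
-- colour determines y from x, and their y's because T is invertible (r ≠ 0). The
-- conclusion holds for all pairs i, j.

module Submission where

open import Algebra.Bundles using (CommutativeRing)
open import Defs

module Counting where

  open import Data.Fin as Fin using (Fin)
  open import Data.Fin.Properties using (_≟_; all?; ¬∀⟶∃¬; punchOut-injective; combine-injective)
  open import Data.List using (List; []; _∷_; length; filter; allFin; map; cartesianProduct)
  open import Data.List.Properties using (length-tabulate; length-++; length-map)
  open import Data.List.Membership.Propositional using (_∈_)
  open import Data.List.Membership.Propositional.Properties using (∈-filter⁻; ∈-allFin)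
  open import Data.List.Relation.Unary.Any using (here; there)
  open import Data.List.Relation.Unary.All as All using ()
  open import Data.List.Relation.Unary.AllPairs using (_∷_)
  open import Data.List.Relation.Unary.Unique.Propositional using (Unique)
  import Data.List.Relation.Unary.Unique.Propositional.Properties as Unique
  open import Data.List.Relation.Binary.Sublist.Propositional.Properties
    using (filter⁺; filter-⊆; length-mono-≤)
  open import Data.Nat using (ℕ; zero; suc; _+_; _*_; _^_; _≤_; _<_; _≤?_; z≤n; s≤s; NonZero; >-nonZero)
  open import Data.Nat.Properties
    using ( +-suc; *-suc; *-assoc; +-mono-≤; *-monoʳ-≤; *-mono-≤; *-mono-<; ≤-trans
          ; m<m+n; m≤n*m; m^n>0; ≰⇒>; <⇒≱; *-commutativeSemigroup; module ≤-Reasoning)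
  open import Algebra.Properties.CommutativeSemigroup *-commutativeSemigroup
    using () renaming (interchange to *-interchange)
  open import Data.Product using (Σ-syntax; ∃-syntax; _×_; _,_; proj₁; proj₂)
  open import Data.Vec using (Vec; []; _∷_)
  open import Function using (_∘_)
  open import Function.Definitions using (Injective)
  open import Level using (0ℓ)
  open import Relation.Binary.Definitions using (DecidableEquality)
  open import Relation.Binary.PropositionalEquality using (_≡_; _≢_; refl; sym; trans; cong; cong₂; subst)
  open import Relation.Nullary using (¬_; yes; no)
  open import Relation.Nullary.Negation using (contradiction)
  open import Relation.Unary using (Pred; Decidable)
  open import Relation.Unary.Properties using (∁?)

  length-allFin : ∀ n → length (allFin n) ≡ n
  length-allFin n = length-tabulate {n = n} (λ i → i)

  module _ {A : Set} where

    length-filter+length-filter-∁ : {P : Pred A 0ℓ} (P? : Decidable P) (xs : List A) →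
      length (filter P? xs) + length (filter (∁? P?) xs) ≡ length xs
    length-filter+length-filter-∁ P? [] = refl
    length-filter+length-filter-∁ P? (x ∷ xs) with P? x
    ... | yes _ = cong suc (length-filter+length-filter-∁ P? xs)
    ... | no _  = trans (+-suc _ _) (cong suc (length-filter+length-filter-∁ P? xs))

    injection-into-unique : ∀ {n} {xs : List A} → Unique xs → n ≤ length xs →
      Σ[ h ∈ (Fin n → A) ] Injective _≡_ _≡_ h × (∀ i → h i ∈ xs)
    injection-into-unique {zero} _ _ = (λ ()) , (λ { {()} }) , λ ()
    injection-into-unique {suc n} {x ∷ xs} (x∉xs ∷ xs-unique) (s≤s n≤|xs|)
      with g , g-injective , g∈xs ← injection-into-unique xs-unique n≤|xs| = h , h-injective , h∈x∷xs
      where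
      h : Fin (suc n) → A
      h Fin.zero    = x
      h (Fin.suc i) = g i
      h-injective : Injective _≡_ _≡_ h
      h-injective {Fin.zero}  {Fin.zero}  _     = refl
      h-injective {Fin.zero}  {Fin.suc j} x≡gj  = contradiction x≡gj (All.lookup x∉xs (g∈xs j))
      h-injective {Fin.suc i} {Fin.zero}  gi≡x  = contradiction (sym gi≡x) (All.lookup x∉xs (g∈xs i))
      h-injective {Fin.suc i} {Fin.suc j} gi≡gj = cong Fin.suc (g-injective gi≡gj)
      h∈x∷xs : ∀ i → h i ∈ x ∷ xs
      h∈x∷xs Fin.zero    = here refl
      h∈x∷xs (Fin.suc i) = there (g∈xs i)

  module Fibres {A C : Set} (_≟ᶜ_ : DecidableEquality C) (f : A → C) where

    fibre : C → List A → List A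
    fibre c = filter (λ x → f x ≟ᶜ c)

    length≤k*#colours : ∀ {k} cs xs → (∀ {x} → x ∈ xs → f x ∈ cs) →
      (∀ c → length (fibre c xs) ≤ k) → length xs ≤ k * length cs
    length≤k*#colours [] [] _ _ = z≤n
    length≤k*#colours [] (x ∷ _) coloured _ with () ← coloured (here refl)
    length≤k*#colours {k} (c ∷ cs) xs coloured small-fibres = begin
      length xs                         ≡⟨ sym (length-filter+length-filter-∁ P? xs) ⟩
      length (fibre c xs) + length rest ≤⟨ +-mono-≤ (small-fibres c) (length≤k*#colours cs rest rest-coloured rest-small-fibres) ⟩
      k + k * length cs                 ≡⟨ sym (*-suc k (length cs)) ⟩
      k * suc (length cs)               ∎
      where
      open ≤-Reasoning
      P? = λ x → f x ≟ᶜ c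
      rest = filter (∁? P?) xs
      rest-coloured : ∀ {x} → x ∈ rest → f x ∈ cs
      rest-coloured x∈rest with x∈xs , fx≢c ← ∈-filter⁻ (∁? P?) x∈rest with coloured x∈xs
      ... | here fx≡c   = contradiction fx≡c fx≢c
      ... | there fx∈cs = fx∈cs
      rest-small-fibres : ∀ c′ → length (fibre c′ rest) ≤ k
      rest-small-fibres c′ = ≤-trans (length-mono-≤ fibre-in-rest⊆fibre) (small-fibres c′)
        where
        Q? = λ x → f x ≟ᶜ c′
        fibre-in-rest⊆fibre = filter⁺ Q? Q? (λ { refl Qx → Qx }) (filter-⊆ (∁? P?) xs)

  module _ {A : Set} {m : ℕ} (f : A → Fin m) where

    open Fibres _≟_ f

    large-fibre : ∀ k xs → k * m < length xs → ∃[ c ] k < length (fibre c xs)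
    large-fibre k xs k*m<|xs| with all? (λ c → length (fibre c xs) ≤? k)
    ... | yes small = contradiction
      (length≤k*#colours (allFin m) xs (λ {x} _ → ∈-allFin (f x)) small)
      (subst (λ n → ¬ length xs ≤ k * n) (sym (length-allFin m)) (<⇒≱ k*m<|xs|))
    ... | no ¬small with c , c-large ← ¬∀⟶∃¬ m _ (λ c → length (fibre c xs) ≤? k) ¬small =
      c , ≰⇒> c-large

    pigeonhole : ∀ k {xs} → Unique xs → k * m < length xs →
      Σ[ h ∈ (Fin (suc k) → A) ] Injective _≡_ _≡_ h × (∀ i → h i ∈ xs) × ∃[ c ] ∀ i → f (h i) ≡ c
    pigeonhole k {xs} xs-unique k*m<|xs| with c , c-large ← large-fibre k xs k*m<|xs| =
      let h , h-injective , h∈fibre = injection-into-unique (Unique.filter⁺ (λ x → f x ≟ c) xs-unique) c-large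
          in-fibre = λ i → ∈-filter⁻ (λ x → f x ≟ c) {xs = xs} (h∈fibre i)
      in h , h-injective , (λ i → proj₁ (in-fibre i)) , c , λ i → proj₂ (in-fibre i)

  length-cartesianProduct : ∀ {A B : Set} (xs : List A) (ys : List B) →
    length (cartesianProduct xs ys) ≡ length xs * length ys
  length-cartesianProduct [] ys = refl
  length-cartesianProduct (x ∷ xs) ys = trans (length-++ (map (x ,_) ys))
    (cong₂ _+_ (length-map (x ,_) ys) (length-cartesianProduct xs ys))

  module _ {n : ℕ} where

    punchOut₂ : {i j k : Fin (suc (suc n))} → i ≢ j → i ≢ k → j ≢ k → Fin n
    punchOut₂ i≢j i≢k j≢k = Fin.punchOut (j≢k ∘ punchOut-injective i≢j i≢k)

    punchOut₂-injective : {i j k l : Fin (suc (suc n))} (i≢j : i ≢ j) {i≢k : i ≢ k} {j≢k : j ≢ k} {i≢l : i ≢ l} {j≢l : j ≢ l} →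
      punchOut₂ i≢j i≢k j≢k ≡ punchOut₂ i≢j i≢l j≢l → k ≡ l
    punchOut₂-injective i≢j {i≢k} {j≢k} {i≢l} {j≢l} =
      punchOut-injective i≢k i≢l ∘ punchOut-injective (j≢k ∘ punchOut-injective i≢j i≢k) (j≢l ∘ punchOut-injective i≢j i≢l)

  module _ {q : ℕ} where

    encodePairs : ∀ {n} → Vec (Fin q × Fin q) n → Fin ((q * q) ^ n)
    encodePairs []             = Fin.zero
    encodePairs ((a , b) ∷ vs) = Fin.combine (Fin.combine a b) (encodePairs vs)

    encodePairs-injective : ∀ {n} → Injective _≡_ _≡_ (encodePairs {n})
    encodePairs-injective {x = []}           {[]}           _  = refl
    encodePairs-injective {x = (a , b) ∷ vs} {(c , e) ∷ ws} eq =
      let ab≡ce , vs≡ws = combine-injective _ _ _ _ eq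
          a≡c , b≡e = combine-injective a b c e ab≡ce
      in cong₂ _∷_ (cong₂ _,_ a≡c b≡e) (encodePairs-injective vs≡ws)

  ^-distribʳ-* : ∀ m n o → (n * o) ^ m ≡ n ^ m * o ^ m
  ^-distribʳ-* zero    n o = refl
  ^-distribʳ-* (suc m) n o = trans (cong (n * o *_) (^-distribʳ-* m n o)) (*-interchange n o (n ^ m) (o ^ m))

  2*k*qᶜ≤e⇒k*[q*q]ᶜ<e*e : ∀ {k q e} c .⦃ _ : NonZero q ⦄ → 1 ≤ k → 2 * k * q ^ c ≤ e →
    k * (q * q) ^ c < e * e
  2*k*qᶜ≤e⇒k*[q*q]ᶜ<e*e {k} {q} {e} c 1≤k 2kQ≤e = begin-strict
    k * (q * q) ^ c ≡⟨ cong (k *_) (^-distribʳ-* c q q) ⟩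
    k * (Q * Q)     ≡⟨ sym (*-assoc k Q Q) ⟩
    k * Q * Q       ≤⟨ *-monoʳ-≤ (k * Q) (m≤n*m Q k ⦃ >-nonZero 1≤k ⦄) ⟩
    k * Q * (k * Q) <⟨ *-mono-< kQ<e kQ<e ⟩
    e * e           ∎
    where
    open ≤-Reasoning
    Q = q ^ c
    kQ<e : k * Q < e
    kQ<e = begin-strict
      k * Q               <⟨ m<m+n (k * Q) (≤-trans (*-mono-≤ 1≤k (m^n>0 q c)) (m≤n*m (k * Q) 1)) ⟩
      k * Q + 1 * (k * Q) ≡⟨ sym (*-assoc 2 k Q) ⟩
      2 * k * Q           ≤⟨ 2kQ≤e ⟩
      e                   ∎

-- The reflective solver of Tactic.RingSolver takes its coefficients from the ring itself
-- and gets stuck on their zero test in an abstract field, hence integer coefficients.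
module IntegerRingSolver {c ℓ} (R : CommutativeRing c ℓ) where

  open import Data.Integer as ℤ using (ℤ; +_; -[1+_]; _⊖_; _◃_; sign; ∣_∣)
  open import Data.Integer.Properties using ([1+m]⊖[1+n]≡m⊖n; ◃-inverse)
  open import Data.Maybe using (map)
  open import Data.Nat as ℕ using (zero; suc)
  open import Data.Nat.Properties using (+-suc)
  open import Data.Sign as Sign using (Sign)
  open import Function using (_∘_)
  import Relation.Binary.PropositionalEquality as ≡
  open import Relation.Nullary.Decidable using (dec⇒maybe)

  open CommutativeRing R
  open import Algebra.Properties.Ring ring using (-‿involutive; -0#≈0#; -1*x≈-x; -‿+-comm)
  open import Algebra.Properties.Semiring.Mult semiring using (_×_; ×-homo-+; ×1-homo-*)
  open import Algebra.Properties.CommutativeSemigroup *-commutativeSemigroup using (interchange)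
  open import Algebra.Solver.Ring.AlmostCommutativeRing using (fromCommutativeRing; _-Raw-AlmostCommutative⟶_)
  open import Relation.Binary.Reasoning.Setoid setoid

  ⟦_⟧ : ℤ → Carrier
  ⟦ + n ⟧      = n × 1#
  ⟦ -[1+ n ] ⟧ = - (suc n × 1#)

  ⟦_⟧ˢ : Sign → Carrier
  ⟦ Sign.+ ⟧ˢ = 1#
  ⟦ Sign.- ⟧ˢ = - 1#

  ⊖-homo : ∀ m n → ⟦ m ⊖ n ⟧ ≈ m × 1# - n × 1#
  ⊖-homo zero    zero    = sym (-‿inverseʳ 0#)
  ⊖-homo (suc m) zero    = sym (trans (+-congˡ -0#≈0#) (+-identityʳ _))
  ⊖-homo zero    (suc n) = sym (+-identityˡ _)
  ⊖-homo (suc m) (suc n) = begin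
    ⟦ suc m ⊖ suc n ⟧              ≡⟨ ≡.cong ⟦_⟧ ([1+m]⊖[1+n]≡m⊖n m n) ⟩
    ⟦ m ⊖ n ⟧                      ≈⟨ ⊖-homo m n ⟩
    M - N                          ≈⟨ +-identityˡ (M - N) ⟨
    0# + (M - N)                   ≈⟨ +-congʳ (-‿inverseʳ 1#) ⟨
    (1# - 1#) + (M - N)            ≈⟨ +-interchange 1# (- 1#) M (- N) ⟩
    (1# + M) + (- 1# + - N)        ≈⟨ +-congˡ (-‿+-comm 1# N) ⟩
    (1# + M) - (1# + N)            ∎
    where
    M = m × 1#
    N = n × 1#
    open import Algebra.Properties.CommutativeSemigroup +-commutativeSemigroup
      using () renaming (interchange to +-interchange)

  +-homo : ∀ i j → ⟦ i ℤ.+ j ⟧ ≈ ⟦ i ⟧ + ⟦ j ⟧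
  +-homo (+ m)    (+ n)    = ×-homo-+ 1# m n
  +-homo (+ m)    -[1+ n ] = ⊖-homo m (suc n)
  +-homo -[1+ m ] (+ n)    = trans (⊖-homo n (suc m)) (+-comm _ _)
  +-homo -[1+ m ] -[1+ n ] = begin
    - (suc (suc (m ℕ.+ n)) × 1#)         ≡⟨ ≡.cong (λ k → - (suc k × 1#)) (+-suc m n) ⟨
    - ((suc m ℕ.+ suc n) × 1#)           ≈⟨ -‿cong (×-homo-+ 1# (suc m) (suc n)) ⟩
    - (suc m × 1# + suc n × 1#)          ≈⟨ -‿+-comm _ _ ⟨
    - (suc m × 1#) + - (suc n × 1#)      ∎

  -‿homo : ∀ i → ⟦ ℤ.- i ⟧ ≈ - ⟦ i ⟧
  -‿homo (+ zero)    = sym -0#≈0#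
  -‿homo (+ suc n)   = refl
  -‿homo -[1+ n ]    = sym (-‿involutive _)

  sign-*-homo : ∀ s t → ⟦ s Sign.* t ⟧ˢ ≈ ⟦ s ⟧ˢ * ⟦ t ⟧ˢ
  sign-*-homo Sign.+ t      = sym (*-identityˡ _)
  sign-*-homo Sign.- Sign.+ = sym (*-identityʳ _)
  sign-*-homo Sign.- Sign.- = sym (trans (-1*x≈-x (- 1#)) (-‿involutive 1#))

  ◃-homo : ∀ s n → ⟦ s ◃ n ⟧ ≈ ⟦ s ⟧ˢ * (n × 1#)
  ◃-homo s      zero    = sym (zeroʳ _)
  ◃-homo Sign.+ (suc n) = sym (*-identityˡ _)
  ◃-homo Sign.- (suc n) = sym (-1*x≈-x _)

  sign-abs : ∀ i → ⟦ i ⟧ ≈ ⟦ sign i ⟧ˢ * (∣ i ∣ × 1#)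
  sign-abs i = trans (reflexive (≡.cong ⟦_⟧ (≡.sym (◃-inverse i)))) (◃-homo (sign i) ∣ i ∣)

  *-homo : ∀ i j → ⟦ i ℤ.* j ⟧ ≈ ⟦ i ⟧ * ⟦ j ⟧
  *-homo i j = begin
    ⟦ i ℤ.* j ⟧                                           ≈⟨ ◃-homo (sign i Sign.* sign j) (∣ i ∣ ℕ.* ∣ j ∣) ⟩
    ⟦ sign i Sign.* sign j ⟧ˢ * ((∣ i ∣ ℕ.* ∣ j ∣) × 1#)   ≈⟨ *-cong (sign-*-homo (sign i) (sign j)) (×1-homo-* ∣ i ∣ ∣ j ∣) ⟩
    (⟦ sign i ⟧ˢ * ⟦ sign j ⟧ˢ) * (∣ i ∣ × 1# * ∣ j ∣ × 1#) ≈⟨ interchange _ _ _ _ ⟩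
    (⟦ sign i ⟧ˢ * ∣ i ∣ × 1#) * (⟦ sign j ⟧ˢ * ∣ j ∣ × 1#) ≈⟨ *-cong (sign-abs i) (sign-abs j) ⟨
    ⟦ i ⟧ * ⟦ j ⟧                                         ∎

  morphism : ℤ.+-*-rawRing -Raw-AlmostCommutative⟶ fromCommutativeRing R
  morphism = record
    { ⟦_⟧ = ⟦_⟧ ; +-homo = +-homo ; *-homo = *-homo ; -‿homo = -‿homo
    ; 0-homo = refl ; 1-homo = +-identityʳ 1# }

  open import Algebra.Solver.Ring ℤ.+-*-rawRing (fromCommutativeRing R) morphism
    (λ i j → map (reflexive ∘ ≡.cong ⟦_⟧) (dec⇒maybe (i ℤ.≟ j))) public
    using (solve; _:=_; _:+_; _:*_; _:-_; con)

module FiniteFields where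

  open import Algebra.Bundles using (CancellativeCommutativeSemiring)
  open import Algebra.Definitions using (AlmostLeftCancellative)
  import Algebra.Properties.CancellativeCommutativeSemiring as CancellativeProperties
  import Algebra.Properties.Ring as RingProperties
  open import Data.Bool using (Bool; true; false)
  open import Data.Empty using (⊥; ⊥-elim)
  open import Data.Fin as Fin using (Fin; punchIn)
  import Data.Integer as ℤ
  open import Data.Fin.Properties using (_≟_; any?; punchIn-injective; punchInᵢ≢i)
  open import Data.List using (List; []; _∷_; length; allFin; cartesianProduct)
  open import Data.List.Relation.Unary.Unique.Propositional using (Unique)
  open import Data.List.Relation.Unary.All using ([]; _∷_)
  open import Data.List.Relation.Unary.AllPairs using ([]; _∷_)
  import Data.List.Relation.Unary.Unique.Propositional.Properties as Unique
  open import Data.Nat as ℕ using (ℕ; zero; suc; ⌈_/2⌉)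
  open import Data.Nat.Properties using (*-monoʳ-<; n<1+n)
  open import Data.Product using (∃₂; _×_; _,_; proj₁; proj₂; Σ-syntax; uncurry)
  open import Data.Product.Properties using (,-injective)
  open import Data.Vec using (Vec; []; _∷_)
  open import Data.Vec.Properties using (∷-injective)
  open import Data.List.Membership.Propositional using (_∈_)
  open import Data.List.Membership.Propositional.Properties using (∈-cartesianProduct⁻)
  open import Data.Sum as Sum using (_⊎_; inj₁; inj₂)
  open import Function using (_∘_)
  open import Function.Definitions using (Injective)
  open import Level using (0ℓ)
  open import Relation.Binary.PropositionalEquality using (_≡_; _≢_; refl; sym; trans; cong; cong₂; subst; module ≡-Reasoning)
  open import Relation.Nullary using (¬_; yes; no)
  open import Relation.Nullary.Negation using (contradiction)
  open Counting using (length-allFin; pigeonhole; punchOut₂; punchOut₂-injective; length-cartesianProduct; encodePairs; encodePairs-injective)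

  module FieldProperties {q : ℕ} (F : FiniteField q) where

    open FiniteField F using (_+_; _*_; -_; 0#; 1#; isCommutativeRing; inverse)

    commutativeRing : CommutativeRing 0ℓ 0ℓ
    commutativeRing = record { isCommutativeRing = isCommutativeRing }

    open CommutativeRing commutativeRing public using (_-_; zeroˡ; zeroʳ; -‿inverseʳ)
    open CommutativeRing commutativeRing using (*-identityˡ; isCommutativeSemiring)
    open RingProperties (CommutativeRing.ring commutativeRing) public
      using (+-cancelˡ; +-cancelʳ; -‿injective; -‿involutive; x∙y⁻¹≈ε⇒x≈y)
    open IntegerRingSolver commutativeRing public using (solve; _:=_; _:+_; _:*_; _:-_; con)
    open ≡-Reasoning

    *-cancelˡ-nonZero : AlmostLeftCancellative _≡_ 0# _*_
    *-cancelˡ-nonZero x y z x≢0 xy≡xz with x⁻¹ , xx⁻¹≡1 ← inverse x x≢0 =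
      trans (sym (x⁻¹-cancels y)) (trans (cong (x⁻¹ *_) xy≡xz) (x⁻¹-cancels z))
      where
      x⁻¹-cancels : ∀ w → x⁻¹ * (x * w) ≡ w
      x⁻¹-cancels w = begin
        x⁻¹ * (x * w) ≡⟨ solve 3 (λ x x⁻¹ w → x⁻¹ :* (x :* w) := (x :* x⁻¹) :* w) refl x x⁻¹ w ⟩
        (x * x⁻¹) * w ≡⟨ cong (_* w) xx⁻¹≡1 ⟩
        1# * w        ≡⟨ *-identityˡ w ⟩
        w             ∎

    cancellativeCommutativeSemiring : CancellativeCommutativeSemiring 0ℓ 0ℓ
    cancellativeCommutativeSemiring = record
      { isCancellativeCommutativeSemiring = record
        { isCommutativeSemiring = isCommutativeSemiring
        ; *-cancelˡ-nonZero     = *-cancelˡ-nonZero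
        }
      }

    x*y≡0⇒x≡0⊎y≡0 : ∀ {x y} → x * y ≡ 0# → x ≡ 0# ⊎ y ≡ 0#
    x*y≡0⇒x≡0⊎y≡0 = CancellativeProperties.xy≈0⇒x≈0∨y≈0 cancellativeCommutativeSemiring _≟_

    x*x≡0⇒x≡0 : ∀ {x} → x * x ≡ 0# → x ≡ 0#
    x*x≡0⇒x≡0 xx≡0 with x*y≡0⇒x≡0⊎y≡0 xx≡0
    ... | inj₁ x≡0 = x≡0
    ... | inj₂ x≡0 = x≡0

    x*x≡y*y⇒y≡x⊎y≡-x : ∀ {x y} → x * x ≡ y * y → y ≡ x ⊎ y ≡ - x
    x*x≡y*y⇒y≡x⊎y≡-x {x} {y} xx≡yy =
      Sum.map (x∙y⁻¹≈ε⇒x≈y y x) (x∙y⁻¹≈ε⇒x≈y y (- x) ∘ trans (cong (y +_) (-‿involutive x)))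
        (x*y≡0⇒x≡0⊎y≡0 (begin
          (y - x) * (y + x) ≡⟨ solve 2 (λ x y → (y :- x) :* (y :+ x) := y :* y :- x :* x) refl x y ⟩
          y * y - x * x     ≡⟨ cong (λ t → y * y - t) xx≡yy ⟩
          y * y - y * y     ≡⟨ -‿inverseʳ (y * y) ⟩
          0#                ∎))

    x-y≡x-z⇒y≡z : ∀ {x y z} → x - y ≡ x - z → y ≡ z
    x-y≡x-z⇒y≡z {x} = -‿injective ∘ +-cancelˡ x _ _

    x-y≡x⇒y≡0 : ∀ {x y} → x - y ≡ x → y ≡ 0#
    x-y≡x⇒y≡0 {x} {y} x-y≡x = begin
      y             ≡⟨ solve 2 (λ x y → y := x :- (x :- y)) refl x y ⟩
      x - (x - y)   ≡⟨ cong (λ t → x - t) x-y≡x ⟩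
      x - x         ≡⟨ -‿inverseʳ x ⟩
      0#            ∎

    x≡z-y⇒x+y≡z : ∀ {x y z} → x ≡ z - y → x + y ≡ z
    x≡z-y⇒x+y≡z {x} {y} {z} x≡z-y = begin
      x + y         ≡⟨ cong (_+ y) x≡z-y ⟩
      (z - y) + y   ≡⟨ solve 2 (λ y z → (z :- y) :+ y := z) refl y z ⟩
      z             ∎

    x-y≡u-v⇒x-u≡y-v : ∀ {x y u v} → x - y ≡ u - v → x - u ≡ y - v
    x-y≡u-v⇒x-u≡y-v {x} {y} {u} {v} x-y≡u-v = begin
      x - u                     ≡⟨ solve 4 (λ x y u v → x :- u := ((x :- y) :- (u :- v)) :+ (y :- v)) refl x y u v ⟩
      (x - y) - (u - v) + (y - v) ≡⟨ cong (λ t → t - (u - v) + (y - v)) x-y≡u-v ⟩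
      (u - v) - (u - v) + (y - v) ≡⟨ solve 3 (λ u v w → (u :- v) :- (u :- v) :+ w := w) refl u v (y - v) ⟩
      y - v                     ∎

  IsSumOfTwoSquares : ∀ {q} → FiniteField q → Fin q → Set
  IsSumOfTwoSquares F r = ∃₂ λ α β → α * α + β * β ≡ r
    where open FiniteField F using (_+_; _*_)

  module TwoSquares {m : ℕ} (F : FiniteField (suc (suc m))) where

    open FiniteField F using (_+_; _*_; -_; 0#)
    open FieldProperties F

    domain : List (Bool × Fin (suc m))
    domain = cartesianProduct (true ∷ false ∷ []) (allFin (suc m))

    domain-unique : Unique domain
    domain-unique = Unique.cartesianProduct⁺ (((λ ()) ∷ []) ∷ [] ∷ []) (Unique.allFin⁺ (suc m))

    2m<|domain| : 2 ℕ.* m ℕ.< length domain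
    2m<|domain| = subst (2 ℕ.* m ℕ.<_) (sym |domain|≡2*[1+m]) (*-monoʳ-< 2 (n<1+n m))
      where
      |domain|≡2*[1+m] = trans (length-cartesianProduct (true ∷ false ∷ []) (allFin (suc m)))
                                (cong (2 ℕ.*_) (length-allFin (suc m)))

    module NotSumOfTwoSquares {r} (¬sos : ¬ IsSumOfTwoSquares F r) where

      ¬square : ∀ a → a * a ≢ r
      ¬square a a²≡r = ¬sos (a , 0# , trans (solve 1 (λ a → a :* a :+ con ℤ.0ℤ :* con ℤ.0ℤ := a :* a) refl a) a²≡r)

      0≢r : 0# ≢ r
      0≢r 0≡r = ¬square 0# (trans (zeroˡ 0#) 0≡r)

      nonzero : Fin (suc m) → Fin (suc (suc m))
      nonzero = punchIn 0#

      value : Bool × Fin (suc m) → Fin (suc (suc m))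
      value (true  , i) = nonzero i * nonzero i
      value (false , i) = r - nonzero i * nonzero i

      value≢0 : ∀ p → 0# ≢ value p
      value≢0 (true  , i) 0≡a² = punchInᵢ≢i 0# i (x*x≡0⇒x≡0 (sym 0≡a²))
      value≢0 (false , i) 0≡r-a² = ¬square (nonzero i) (sym (x∙y⁻¹≈ε⇒x≈y r _ (sym 0≡r-a²)))

      value≢r : ∀ p → r ≢ value p
      value≢r (true  , i) r≡a² = ¬square (nonzero i) (sym r≡a²)
      value≢r (false , i) r≡r-a² = punchInᵢ≢i 0# i (x*x≡0⇒x≡0 (x-y≡x⇒y≡0 (sym r≡r-a²)))

      colour : Bool × Fin (suc m) → Fin m
      colour p = punchOut₂ 0≢r (value≢0 p) (value≢r p)

      colour-injective : ∀ p p′ → colour p ≡ colour p′ → value p ≡ value p′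
      colour-injective p p′ = punchOut₂-injective 0≢r {value≢0 p} {value≢r p} {value≢0 p′} {value≢r p′}

      equal-squares⇒opposite : ∀ {i j} → i ≢ j →
        nonzero i * nonzero i ≡ nonzero j * nonzero j → nonzero j ≡ - nonzero i
      equal-squares⇒opposite {i} {j} i≢j a²≡b² with x*x≡y*y⇒y≡x⊎y≡-x a²≡b²
      ... | inj₁ b≡a  = contradiction (punchIn-injective 0# i j (sym b≡a)) i≢j
      ... | inj₂ b≡-a = b≡-a

      same-value⇒opposite : ∀ p p′ → p ≢ p′ → value p ≡ value p′ →
        proj₁ p ≡ proj₁ p′ × nonzero (proj₂ p′) ≡ - nonzero (proj₂ p)
      same-value⇒opposite (true  , i) (true  , j) ne a²≡b² =
        refl , equal-squares⇒opposite (ne ∘ cong (true ,_)) a²≡b²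
      same-value⇒opposite (false , i) (false , j) ne r-a²≡r-b² =
        refl , equal-squares⇒opposite (ne ∘ cong (false ,_)) (x-y≡x-z⇒y≡z r-a²≡r-b²)
      same-value⇒opposite (true  , i) (false , j) _ a²≡r-b² =
        ⊥-elim (¬sos (nonzero i , nonzero j , x≡z-y⇒x+y≡z a²≡r-b²))
      same-value⇒opposite (false , i) (true  , j) _ r-a²≡b² =
        ⊥-elim (¬sos (nonzero j , nonzero i , x≡z-y⇒x+y≡z (sym r-a²≡b²)))

      value-at-most-twice : (h : Fin 3 → Bool × Fin (suc m)) → (∀ k l → value (h k) ≡ value (h l)) →
        ¬ Injective _≡_ _≡_ h
      value-at-most-twice h same-value h-injective = contradiction (h-injective h₁≡h₂) λ ()
        where
        opposite-of-h₀ : ∀ k → k ≢ Fin.zero →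
          proj₁ (h Fin.zero) ≡ proj₁ (h k) × nonzero (proj₂ (h k)) ≡ - nonzero (proj₂ (h Fin.zero))
        opposite-of-h₀ k k≢0 = same-value⇒opposite (h Fin.zero) (h k) (k≢0 ∘ sym ∘ h-injective) (same-value Fin.zero k)
        h₁≡h₂ : h (Fin.suc Fin.zero) ≡ h (Fin.suc (Fin.suc Fin.zero))
        h₁≡h₂ =
          let s₁ , a₁ = opposite-of-h₀ (Fin.suc Fin.zero) (λ ())
              s₂ , a₂ = opposite-of-h₀ (Fin.suc (Fin.suc Fin.zero)) (λ ())
          in cong₂ _,_ (trans (sym s₁) s₂) (punchIn-injective 0# _ _ (trans a₁ (sym a₂)))

      absurd : ⊥
      absurd =
        let h , h-injective , _ , _ , same-colour = pigeonhole colour 2 domain-unique 2m<|domain|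
            same-value = λ k l → colour-injective (h k) (h l) (trans (same-colour k) (sym (same-colour l)))
        in value-at-most-twice h same-value h-injective

    sumOfTwoSquares : ∀ r → IsSumOfTwoSquares F r
    sumOfTwoSquares r with any? (λ α → any? (λ β → α * α + β * β ≟ r))
    ... | yes sos = sos
    ... | no ¬sos = ⊥-elim (NotSumOfTwoSquares.absurd ¬sos)

  sumOfTwoSquares : ∀ {q} (F : FiniteField q) r → IsSumOfTwoSquares F r
  sumOfTwoSquares {suc (suc m)} F = TwoSquares.sumOfTwoSquares F
  sumOfTwoSquares {suc zero}    F _ with FiniteField.0# F | FiniteField.1# F | FiniteField.0≢1 F
  ... | Fin.zero | Fin.zero | 0≢1 = ⊥-elim (0≢1 refl)

  module Similarity {q : ℕ} (F : FiniteField q) (α β : Fin q) where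

    open FiniteField F using (_+_; _*_; -_; 0#; Point; _-ᵥ_; ‖_‖²)
    open FieldProperties F
    open ≡-Reasoning

    r : Fin q
    r = α * α + β * β

    rotate₁ rotate₂ : Fin q → Fin q → Fin q
    rotate₁ a b = α * a - β * b
    rotate₂ a b = β * a + α * b

    rotate-norm : ∀ a b S → rotate₁ a b * rotate₁ a b + (rotate₂ a b * rotate₂ a b + r * S) ≡ r * (a * a + (b * b + S))
    rotate-norm = solve 5 (λ α β a b S →
        (α :* a :- β :* b) :* (α :* a :- β :* b) :+ ((β :* a :+ α :* b) :* (β :* a :+ α :* b) :+ (α :* α :+ β :* β) :* S)
      := (α :* α :+ β :* β) :* (a :* a :+ (b :* b :+ S))) refl α β

    rotate₁-sub : ∀ a b a′ b′ → rotate₁ a b - rotate₁ a′ b′ ≡ rotate₁ (a - a′) (b - b′)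
    rotate₁-sub = solve 6 (λ α β a b a′ b′ →
      (α :* a :- β :* b) :- (α :* a′ :- β :* b′) := α :* (a :- a′) :- β :* (b :- b′)) refl α β

    rotate₂-sub : ∀ a b a′ b′ → rotate₂ a b - rotate₂ a′ b′ ≡ rotate₂ (a - a′) (b - b′)
    rotate₂-sub = solve 6 (λ α β a b a′ b′ →
      (β :* a :+ α :* b) :- (β :* a′ :+ α :* b′) := β :* (a :- a′) :+ α :* (b :- b′)) refl α β

    rotate-inverse₁ : ∀ a b → r * a ≡ α * rotate₁ a b + β * rotate₂ a b
    rotate-inverse₁ = solve 4 (λ α β a b →
      (α :* α :+ β :* β) :* a := α :* (α :* a :- β :* b) :+ β :* (β :* a :+ α :* b)) refl α β

    rotate-inverse₂ : ∀ a b → r * b ≡ α * rotate₂ a b - β * rotate₁ a b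
    rotate-inverse₂ = solve 4 (λ α β a b →
      (α :* α :+ β :* β) :* b := α :* (β :* a :+ α :* b) :- β :* (α :* a :- β :* b)) refl α β

    rotate-injective : r ≢ 0# → ∀ {a b a′ b′} → rotate₁ a b ≡ rotate₁ a′ b′ → rotate₂ a b ≡ rotate₂ a′ b′ →
      a ≡ a′ × b ≡ b′
    rotate-injective r≢0 {a} {b} {a′} {b′} X≡X′ Y≡Y′ =
      *-cancelˡ-nonZero r a a′ r≢0 (begin
        r * a                                ≡⟨ rotate-inverse₁ a b ⟩
        α * rotate₁ a b + β * rotate₂ a b     ≡⟨ cong₂ (λ X Y → α * X + β * Y) X≡X′ Y≡Y′ ⟩
        α * rotate₁ a′ b′ + β * rotate₂ a′ b′ ≡⟨ sym (rotate-inverse₁ a′ b′) ⟩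
        r * a′                               ∎) ,
      *-cancelˡ-nonZero r b b′ r≢0 (begin
        r * b                                ≡⟨ rotate-inverse₂ a b ⟩
        α * rotate₂ a b - β * rotate₁ a b     ≡⟨ cong₂ (λ X Y → α * Y - β * X) X≡X′ Y≡Y′ ⟩
        α * rotate₂ a′ b′ - β * rotate₁ a′ b′ ≡⟨ sym (rotate-inverse₂ a′ b′) ⟩
        r * b′                               ∎)

    -- The colour of (x, y): y − (α + βi) x on consecutive pairs of coordinates, and the
    -- pair (x_d, y_d) itself for an unpaired last coordinate.
    blockKey : (a b c e : Fin q) → Fin q × Fin q
    blockKey a b c e = c - rotate₁ a b , e - rotate₂ a b

    key : ∀ {d} → Point d → Point d → Vec (Fin q × Fin q) ⌈ d /2⌉
    key []          []          = []
    key (a ∷ [])    (c ∷ [])    = (a , c) ∷ []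
    key (a ∷ b ∷ x) (c ∷ e ∷ y) = blockKey a b c e ∷ key x y

    same-key⇒‖y-y′‖²≡r*‖x-x′‖² : ∀ {d} (x x′ y y′ : Point d) → key x y ≡ key x′ y′ →
      ‖ y -ᵥ y′ ‖² ≡ r * ‖ x -ᵥ x′ ‖²
    same-key⇒‖y-y′‖²≡r*‖x-x′‖² [] [] [] [] _ = sym (zeroʳ r)
    same-key⇒‖y-y′‖²≡r*‖x-x′‖² (a ∷ []) (a ∷ []) (c ∷ []) (c ∷ []) refl =
      solve 4 (λ α β a c → (c :- c) :* (c :- c) :+ con ℤ.0ℤ := (α :* α :+ β :* β) :* ((a :- a) :* (a :- a) :+ con ℤ.0ℤ)) refl α β a c
    same-key⇒‖y-y′‖²≡r*‖x-x′‖² (a ∷ b ∷ x) (a′ ∷ b′ ∷ x′) (c ∷ e ∷ y) (c′ ∷ e′ ∷ y′) keys≡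
      with block≡ , tail≡ ← ∷-injective keys≡
      with c-X≡c′-X′ , e-Y≡e′-Y′ ← ,-injective block≡ = begin
        (c - c′) * (c - c′) + ((e - e′) * (e - e′) + ‖ y -ᵥ y′ ‖²)
          ≡⟨ cong₂ (λ u v → u * u + (v * v + ‖ y -ᵥ y′ ‖²)) c-c′≡U e-e′≡V ⟩
        U * U + (V * V + ‖ y -ᵥ y′ ‖²)
          ≡⟨ cong (λ t → U * U + (V * V + t)) (same-key⇒‖y-y′‖²≡r*‖x-x′‖² x x′ y y′ tail≡) ⟩
        U * U + (V * V + r * ‖ x -ᵥ x′ ‖²)
          ≡⟨ rotate-norm (a - a′) (b - b′) ‖ x -ᵥ x′ ‖² ⟩
        r * ((a - a′) * (a - a′) + ((b - b′) * (b - b′) + ‖ x -ᵥ x′ ‖²)) ∎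
      where
      U = rotate₁ (a - a′) (b - b′)
      V = rotate₂ (a - a′) (b - b′)
      c-c′≡U : c - c′ ≡ U
      c-c′≡U = trans (x-y≡u-v⇒x-u≡y-v c-X≡c′-X′) (rotate₁-sub a b a′ b′)
      e-e′≡V : e - e′ ≡ V
      e-e′≡V = trans (x-y≡u-v⇒x-u≡y-v e-Y≡e′-Y′) (rotate₂-sub a b a′ b′)

    key-injectiveʳ : ∀ {d} (x y y′ : Point d) → key x y ≡ key x y′ → y ≡ y′
    key-injectiveʳ [] [] [] _ = refl
    key-injectiveʳ (a ∷ []) (c ∷ []) (c ∷ []) refl = refl
    key-injectiveʳ (a ∷ b ∷ x) (c ∷ e ∷ y) (c′ ∷ e′ ∷ y′) keys≡ =
      let block≡ , tail≡ = ∷-injective keys≡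
          c-X≡c′-X , e-Y≡e′-Y = ,-injective block≡
      in cong₂ _∷_ (+-cancelʳ _ c c′ c-X≡c′-X) (cong₂ _∷_ (+-cancelʳ _ e e′ e-Y≡e′-Y) (key-injectiveʳ x y y′ tail≡))

    key-injectiveˡ : r ≢ 0# → ∀ {d} (x x′ y : Point d) → key x y ≡ key x′ y → x ≡ x′
    key-injectiveˡ r≢0 [] [] [] _ = refl
    key-injectiveˡ r≢0 (a ∷ []) (a ∷ []) (c ∷ []) refl = refl
    key-injectiveˡ r≢0 (a ∷ b ∷ x) (a′ ∷ b′ ∷ x′) (c ∷ e ∷ y) keys≡ =
      let block≡ , tail≡ = ∷-injective keys≡
          c-X≡c-X′ , e-Y≡e-Y′ = ,-injective block≡
          a≡a′ , b≡b′ = rotate-injective r≢0 {a} {b} {a′} {b′} (x-y≡x-z⇒y≡z c-X≡c-X′) (x-y≡x-z⇒y≡z e-Y≡e-Y′)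
      in cong₂ _∷_ a≡a′ (cong₂ _∷_ b≡b′ (key-injectiveˡ r≢0 x x′ y tail≡))

    same-key⇒similar : ∀ {d n} (x y : Fin n → Point d) → r ≢ 0# →
      (∀ i j → key (x i) (y i) ≡ key (x j) (y j)) → Injective _≡_ _≡_ (λ i → x i , y i) →
      (∀ i j → ‖ y i -ᵥ y j ‖² ≡ r * ‖ x i -ᵥ x j ‖²) × (∀ {i j} → i ≢ j → x i ≢ x j × y i ≢ y j)
    same-key⇒similar x y r≢0 same-key pairs-injective = similar , distinct
      where
      similar : ∀ i j → ‖ y i -ᵥ y j ‖² ≡ r * ‖ x i -ᵥ x j ‖²
      similar i j = same-key⇒‖y-y′‖²≡r*‖x-x′‖² (x i) (x j) (y i) (y j) (same-key i j)
      distinct : ∀ {i j} → i ≢ j → x i ≢ x j × y i ≢ y j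
      distinct {i} {j} i≢j =
        (λ xi≡xj → i≢j (pairs-injective (cong₂ _,_ xi≡xj (y-determined xi≡xj)))) ,
        (λ yi≡yj → i≢j (pairs-injective (cong₂ _,_ (x-determined yi≡yj) yi≡yj)))
        where
        y-determined : x i ≡ x j → y i ≡ y j
        y-determined xi≡xj =
          key-injectiveʳ (x i) (y i) (y j) (trans (same-key i j) (cong (λ z → key z (y j)) (sym xi≡xj)))
        x-determined : y i ≡ y j → x i ≡ x j
        x-determined yi≡yj =
          key-injectiveˡ r≢0 (x i) (x j) (y i) (trans (same-key i j) (cong (key (x j)) (sym yi≡yj)))

    similar-tuples : r ≢ 0# → ∀ {d} k (E : List (Point d)) → Unique E →
      k ℕ.* (q ℕ.* q) ℕ.^ ⌈ d /2⌉ ℕ.< length E ℕ.* length E →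
      Σ[ x ∈ (Fin (suc k) → Point d) ] Σ[ y ∈ (Fin (suc k) → Point d) ]
        (∀ i → x i ∈ E) × (∀ i → y i ∈ E) ×
        (∀ i j → ‖ y i -ᵥ y j ‖² ≡ r * ‖ x i -ᵥ x j ‖²) × (∀ {i j} → i ≢ j → x i ≢ x j × y i ≢ y j)
    similar-tuples r≢0 {d} k E E-unique bound =
      let h , h-injective , h∈E² , _ , same-colour = pigeonhole (encodePairs ∘ uncurry key) k
            (Unique.cartesianProduct⁺ E-unique E-unique)
            (subst (k ℕ.* (q ℕ.* q) ℕ.^ ⌈ d /2⌉ ℕ.<_) (sym (length-cartesianProduct E E)) bound)
          x = proj₁ ∘ h
          y = proj₂ ∘ h
          same-key = λ i j → encodePairs-injective (trans (same-colour i) (sym (same-colour j)))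
      in x , y , proj₁ ∘ ∈-cartesianProduct⁻ E E ∘ h∈E² , proj₂ ∘ ∈-cartesianProduct⁻ E E ∘ h∈E² ,
         same-key⇒similar x y r≢0 same-key h-injective

open import Data.Nat using (ℕ; suc; _*_; _^_; _≤_; _≥_; ⌈_/2⌉)
open import Data.Fin using (Fin; _<_)
open import Data.List using (List; []; length)
open import Data.List.Membership.Propositional using (_∈_)
open import Data.List.Relation.Unary.All using (All)
open import Data.List.Relation.Unary.Unique.Propositional using (Unique)
open import Data.Product using (_×_; _,_; Σ-syntax)
open import Relation.Binary.PropositionalEquality using (_≡_; refl)
open import Relation.Nullary using (¬_)
open import Data.Fin.Properties using (<⇒≢; nonZeroIndex)
open Counting using (2*k*qᶜ≤e⇒k*[q*q]ᶜ<e*e)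
open FiniteFields using (sumOfTwoSquares; module Similarity)

theorem2p2 : (q : ℕ) → IsPrimePower q → (F : FiniteField q) → (d k : ℕ) → d ≥ 1 → k ≥ 1
  → (r : Fin q) → ¬ (r ≡ FiniteField.0# F)
  → (A : List (Fin (suc k) × Fin (suc k))) → ¬ (A ≡ []) → All (λ p → Data.Product.proj₁ p < Data.Product.proj₂ p) A
  → (E : List (FiniteField.Point F d)) → Unique E
  → 2 * k * q ^ ⌈ d /2⌉ ≤ length E
  → Σ[ x ∈ (Fin (suc k) → FiniteField.Point F d) ] Σ[ y ∈ (Fin (suc k) → FiniteField.Point F d) ] ((∀ i → x i ∈ E) × (∀ i → y i ∈ E)
    × (∀ i j → (i , j) ∈ A
       → FiniteField.‖_‖² F (FiniteField._-ᵥ_ F (y i) (y j))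
         ≡ FiniteField._*_ F r (FiniteField.‖_‖² F (FiniteField._-ᵥ_ F (x i) (x j))))
    × (∀ (i j : Fin (suc k)) → i < j → ¬ (x i ≡ x j) × ¬ (y i ≡ y j)))
theorem2p2 q _ F d k _ 1≤k r r≢0 _ _ _ E E-unique 2kqᶜ≤|E| with α , β , refl ← sumOfTwoSquares F r =
  let x , y , x∈E , y∈E , similar , distinct = Similarity.similar-tuples F α β r≢0 k E E-unique
        (2*k*qᶜ≤e⇒k*[q*q]ᶜ<e*e ⌈ d /2⌉ ⦃ nonZeroIndex r ⦄ 1≤k 2kqᶜ≤|E|)
  in x , y , x∈E , y∈E , (λ i j _ → similar i j) , λ i j i<j → distinct (<⇒≢ i<j)
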